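{- Let $G=(V_1\cup V_2,E)$ be a $k$-regular bipartite graph with bipartition $V_1,V_2$ and $|V_1|=|V_2|=n$. If $k>\lceil n/2\rceil$, then $rc(G)\leq 12$.
   Context: Graphs are finite and simple. A path in an edge-colored graph is rainbow if no two of its edges share a color; $rc(G)$ is the minimum number of colors in an edge-coloring of $G$ in which every two distinct vertices are joined by a rainbow path. -}

module Defs where

open import Data.Nat using (ℕ; zero; suc; _+_)
open import Data.Fin using (Fin; zero; suc)
open import Data.Bool using (Bool; true; false; if_then_else_)
open import Data.Empty using (⊥)
open import Data.Sum using (_⊎_; inj₁; inj₂)
open import Data.List using (List; []; _∷_)
open import Data.List.Relation.Unary.Unique.Propositional using (Unique)
open import Data.Product using (Σ; _×_; _,_; ∃)
open import Relation.Binary.PropositionalEquality using (_≡_; _≢_)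

count : {n : ℕ} → (Fin n → Bool) → ℕ
count {zero}  f = 0
count {suc n} f = (if f zero then 1 else 0) + count (λ i → f (suc i))

-- A (simple) bipartite graph with parts V₁ = Fin n₁ and V₂ = Fin n₂,
-- given by its biadjacency relation: E i j = true iff i ∈ V₁ and j ∈ V₂ are adjacent.
-- Simplicity is automatic: no loops, no multiple edges.
BipGraph : ℕ → ℕ → Set
BipGraph n₁ n₂ = Fin n₁ → Fin n₂ → Bool

Vertex : ℕ → ℕ → Set
Vertex n₁ n₂ = Fin n₁ ⊎ Fin n₂

Adj : {n₁ n₂ : ℕ} → BipGraph n₁ n₂ → Vertex n₁ n₂ → Vertex n₁ n₂ → Set
Adj E (inj₁ i) (inj₂ j) = E i j ≡ true
Adj E (inj₂ j) (inj₁ i) = E i j ≡ true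
Adj E (inj₁ _) (inj₁ _) = ⊥
Adj E (inj₂ _) (inj₂ _) = ⊥

Regular : {n₁ n₂ : ℕ} → BipGraph n₁ n₂ → ℕ → Set
Regular E k = (∀ i → count (λ j → E i j) ≡ k) × (∀ j → count (λ i → E i j) ≡ k)

-- an edge-colouring with colours from Fin c; the colour of edge {i,j} (i ∈ V₁, j ∈ V₂)
-- is col i j (values on non-edges are irrelevant)
Colouring : {n₁ n₂ : ℕ} → BipGraph n₁ n₂ → ℕ → Set
Colouring {n₁} {n₂} E c = Fin n₁ → Fin n₂ → Fin c

data Walk {n₁ n₂ : ℕ} (E : BipGraph n₁ n₂) : Vertex n₁ n₂ → Vertex n₁ n₂ → Set where
  here : ∀ {u} → Walk E u u
  step : ∀ {u w v} → Adj E u w → Walk E w v → Walk E u v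

vertices : ∀ {n₁ n₂} {E : BipGraph n₁ n₂} {u v} → Walk E u v → List (Vertex n₁ n₂)
vertices {u = u} here = u ∷ []
vertices {u = u} (step _ p) = u ∷ vertices p

edgeCol : ∀ {n₁ n₂ c} {E : BipGraph n₁ n₂} → Colouring E c →
          ∀ {u w} → Adj E u w → Fin c
edgeCol col {inj₁ i} {inj₂ j} _ = col i j
edgeCol col {inj₂ j} {inj₁ i} _ = col i j
edgeCol col {inj₁ _} {inj₁ _} ()
edgeCol col {inj₂ _} {inj₂ _} ()

colours : ∀ {n₁ n₂ c} {E : BipGraph n₁ n₂} → Colouring E c →
          ∀ {u v} → Walk E u v → List (Fin c)
colours col here = []
colours col (step a p) = edgeCol col a ∷ colours col p

IsPath : ∀ {n₁ n₂} {E : BipGraph n₁ n₂} {u v} → Walk E u v → Set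
IsPath p = Unique (vertices p)

RainbowPath : ∀ {n₁ n₂ c} {E : BipGraph n₁ n₂} → Colouring E c →
              ∀ {u v} → Walk E u v → Set
RainbowPath col p = IsPath p × Unique (colours col p)

RainbowConnected : ∀ {n₁ n₂ c} {E : BipGraph n₁ n₂} → Colouring E c → Set
RainbowConnected {E = E} col =
  ∀ u v → u ≢ v → Σ (Walk E u v) (λ p → RainbowPath col p)

rc≤ : ∀ {n₁ n₂} → BipGraph n₁ n₂ → ℕ → Set
rc≤ E c = Σ (Colouring E c) (λ col → RainbowConnected {E = E} col)

module Submission where

-- Write k for the common degree and n for the size of each side.
-- Since ⌈n/2⌉ < k we have 2k ≥ n + 2, so any two vertices on the same side
-- share at least two neighbours.  Fix an edge rs (r ∈ V₁, s ∈ V₂) and sort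
-- the vertices into three classes relative to it:
--   V₁ = {r} ∪ C ∪ D   with C = N(s) ∖ {r},  D = V₁ ∖ N(s),
--   V₂ = {s} ∪ A ∪ B   with A = N(r) ∖ {s},  B = V₂ ∖ N(r).
-- Colour each edge by the pair (class of its V₁-end, class of its V₂-end);
-- this uses 9 ≤ 12 colours.  Density provides the connecting vertices:
-- every vertex of V₁ has a neighbour in A, every vertex of V₂ one in C,
-- every vertex of D one in B and every vertex of B one in D.  From these,
-- an explicit walk of length at most 6 through the edge rs joins any two
-- vertices, and its colours are distinct (a closed computation on classes).
-- Finally every rainbow walk can be shortened to a rainbow path.

open import Data.Nat using (ℕ; zero; suc; _+_; _≤_; _<_; z≤n; s≤s; ⌈_/2⌉)
open import Data.Nat.Properties
  using (+-comm; +-suc; +-mono-≤; +-monoʳ-≤; +-monoˡ-≤; +-cancelˡ-≤; ≤-trans; ≤-pred;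
         ≤-reflexive; m≤n⇒m≤1+n; m≤m+n; ⌊n/2⌋+⌈n/2⌉≡n; ⌊n/2⌋≤⌈n/2⌉; module ≤-Reasoning)
open import Data.Fin using (Fin; zero; suc; combine; inject≤; _≟_)
open import Data.Fin.Properties using (suc-injective)
open import Data.Bool using (Bool; true; false; if_then_else_; _∧_; not)
open import Data.Bool.Properties using (∧-comm)
open import Data.Sum using (inj₁; inj₂)
open import Data.Sum.Properties using (≡-dec)
open import Data.Product using (Σ; _×_; _,_; ∃; proj₁; proj₂)
open import Data.List using (List; []; _∷_; _++_; reverse; [_])
open import Data.List.Properties using (unfold-reverse)
open import Data.List.Relation.Unary.All using ([])
open import Data.List.Relation.Unary.All.Properties using (¬Any⇒All¬)
open import Data.List.Relation.Unary.Any using (here; there)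
open import Data.List.Relation.Unary.AllPairs using ([]; _∷_)
open import Data.List.Relation.Unary.Unique.Propositional using (Unique)
open import Data.List.Relation.Unary.Unique.DecPropositional (_≟_ {12}) using (unique?)
open import Data.List.Membership.Propositional using (_∈_)
import Data.List.Membership.DecPropositional as DecMembership
open import Data.List.Relation.Binary.Sublist.Propositional using (_⊆_; []; _∷_; _∷ʳ_; ⊆-refl; ⊆-trans)
open import Data.List.Relation.Binary.Sublist.Propositional.Properties using (All-resp-⊆)
import Data.List.Relation.Binary.Permutation.Setoid as Permutation
import Data.List.Relation.Binary.Permutation.Setoid.Properties as PermutationProperties
open import Relation.Binary.PropositionalEquality
  using (_≡_; _≢_; refl; sym; trans; cong; cong₂; subst; setoid; module ≡-Reasoning)
open import Relation.Nullary using (yes; no; does)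
open import Relation.Nullary.Decidable using (True; toWitness; dec-true; dec-false)
open import Function using (_∘_)
open import Defs

∧-true : ∀ {x y} → x ∧ y ≡ true → x ≡ true × y ≡ true
∧-true {true} {true} _ = refl , refl

not-true : ∀ {x} → not x ≡ true → x ≡ false
not-true {false} _ = refl

count-cong : ∀ {n} {f g : Fin n → Bool} → (∀ i → f i ≡ g i) → count f ≡ count g
count-cong {zero} _ = refl
count-cong {suc n} eq = cong₂ (λ b m → (if b then 1 else 0) + m) (eq zero) (count-cong (eq ∘ suc))

count-split : ∀ {n} (f g : Fin n → Bool) →
              count f ≡ count (λ i → f i ∧ g i) + count (λ i → f i ∧ not (g i))
count-split {zero} f g = refl
count-split {suc n} f g with f zero | g zero | count-split (f ∘ suc) (g ∘ suc)
... | true  | true  | ih = cong suc ih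
... | true  | false | ih = trans (cong suc ih) (sym (+-suc _ _))
... | false | _     | ih = ih

count-overlap : ∀ {n} (f g : Fin n → Bool) → count f + count g ≤ n + count (λ i → f i ∧ g i)
count-overlap {zero} f g = z≤n
count-overlap {suc n} f g with f zero | g zero | count-overlap (f ∘ suc) (g ∘ suc)
... | true  | true  | ih = s≤s (≤-trans (≤-reflexive (+-suc _ _))
                                (≤-trans (s≤s ih) (≤-reflexive (sym (+-suc _ _)))))
... | true  | false | ih = s≤s ih
... | false | true  | ih = ≤-trans (≤-reflexive (+-suc _ _)) (s≤s ih)
... | false | false | ih = m≤n⇒m≤1+n ih

count-pos : ∀ {n} (f : Fin n → Bool) (s : Fin n) → f s ≡ true → 1 ≤ count f
count-pos f zero fs rewrite fs = s≤s z≤n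
count-pos f (suc s) fs with f zero
... | true  = s≤s z≤n
... | false = count-pos (f ∘ suc) s fs

witness : ∀ {n} (f : Fin n → Bool) → 1 ≤ count f → ∃ λ i → f i ≡ true
witness {suc n} f pos with f zero in f0
... | true  = zero , f0
... | false with witness (f ∘ suc) pos
...   | i , fi = suc i , fi

witness-avoiding : ∀ {n} (f : Fin n → Bool) → 2 ≤ count f → ∀ s → ∃ λ a → f a ≡ true × a ≢ s
witness-avoiding {suc n} f two s with f zero in f0 | s
... | true  | suc _ = zero , f0 , λ ()
... | true  | zero with witness (f ∘ suc) (≤-pred two)
...   | a , fa = suc a , fa , λ ()
witness-avoiding {suc n} f two s | false | zero with witness (f ∘ suc) (≤-trans (s≤s z≤n) two)
...   | a , fa = suc a , fa , λ ()
witness-avoiding {suc n} f two s | false | suc s′ with witness-avoiding (f ∘ suc) two s′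
...   | a , fa , a≢s′ = suc a , fa , a≢s′ ∘ suc-injective

common-element : ∀ {n k} (f g : Fin n → Bool) → count f ≡ k → count g ≡ k → n + 2 ≤ k + k →
                 ∀ s → ∃ λ a → f a ≡ true × g a ≡ true × a ≢ s
common-element {n} {k} f g |f| |g| dense s with witness-avoiding _ two-common s
  where
  two-common : 2 ≤ count (λ i → f i ∧ g i)
  two-common = +-cancelˡ-≤ n 2 _ (begin
    n + 2                            ≤⟨ dense ⟩
    k + k                            ≡⟨ cong₂ _+_ |f| |g| ⟨
    count f + count g                ≤⟨ count-overlap f g ⟩
    n + count (λ i → f i ∧ g i)      ∎)
    where open ≤-Reasoning
... | a , fga , a≢s = a , proj₁ (∧-true fga) , proj₂ (∧-true fga) , a≢s

element-outside : ∀ {n} (f g : Fin n → Bool) → count g ≤ count f →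
                  ∀ s → g s ≡ true → f s ≡ false → ∃ λ b → f b ≡ true × g b ≡ false
element-outside f g |g|≤|f| s gs fs with witness (λ i → f i ∧ not (g i)) f∖g-nonempty
  where
  X = count (λ i → f i ∧ g i)
  g∖f-nonempty : 1 ≤ count (λ i → g i ∧ not (f i))
  g∖f-nonempty = count-pos _ s (cong₂ (λ x y → x ∧ not y) gs fs)
  |g|-split : count g ≡ X + count (λ i → g i ∧ not (f i))
  |g|-split = trans (count-split g f)
    (cong (_+ count (λ i → g i ∧ not (f i))) (count-cong (λ i → ∧-comm (g i) (f i))))
  f∖g-nonempty : 1 ≤ count (λ i → f i ∧ not (g i))
  f∖g-nonempty = +-cancelˡ-≤ X 1 _ (begin
    X + 1                                   ≤⟨ +-monoʳ-≤ X g∖f-nonempty ⟩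
    X + count (λ i → g i ∧ not (f i))       ≡⟨ sym |g|-split ⟩
    count g                                 ≤⟨ |g|≤|f| ⟩
    count f                                 ≡⟨ count-split f g ⟩
    X + count (λ i → f i ∧ not (g i))       ∎)
    where open ≤-Reasoning
... | b , fb¬gb = b , proj₁ (∧-true fb¬gb) , not-true (proj₂ (∧-true fb¬gb))

dense-bound : ∀ n k → ⌈ n /2⌉ < k → n + 2 ≤ k + k
dense-bound n k h<k = begin
  n + 2              ≡⟨ +-comm n 2 ⟩
  suc (suc n)        ≤⟨ s≤s (s≤s n≤h+h) ⟩
  suc (suc (h + h))  ≡⟨ cong suc (+-suc h h) ⟨
  suc h + suc h      ≤⟨ +-mono-≤ h<k h<k ⟩
  k + k              ∎
  where
  open ≤-Reasoning
  h = ⌈ n /2⌉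
  n≤h+h : n ≤ h + h
  n≤h+h = subst (_≤ h + h) (⌊n/2⌋+⌈n/2⌉≡n n) (+-monoˡ-≤ h (⌊n/2⌋≤⌈n/2⌉ n))

unique-sublist : ∀ {A : Set} {xs ys : List A} → xs ⊆ ys → Unique ys → Unique xs
unique-sublist [] [] = []
unique-sublist (_ ∷ʳ τ) (_ ∷ u) = unique-sublist τ u
unique-sublist (refl ∷ τ) (x∉ys ∷ u) = All-resp-⊆ τ x∉ys ∷ unique-sublist τ u

unique-reverse : ∀ {A : Set} (xs : List A) → Unique xs → Unique (reverse xs)
unique-reverse {A} xs = Unique-resp-↭ (↭-sym (↭-reverse xs))
  where
  open Permutation (setoid A) using (↭-sym)
  open PermutationProperties (setoid A) using (Unique-resp-↭; ↭-reverse)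

module Walks {n₁ n₂ c : ℕ} (E : BipGraph n₁ n₂) (col : Colouring E c) where

  open DecMembership (≡-dec (_≟_ {n₁}) (_≟_ {n₂})) using (_∈?_)

  RainbowWalk : Vertex n₁ n₂ → Vertex n₁ n₂ → Set
  RainbowWalk u v = Σ (Walk E u v) λ p → Unique (colours col p)

  _++ᵂ_ : ∀ {u v w} → Walk E u v → Walk E v w → Walk E u w
  here     ++ᵂ q = q
  step a p ++ᵂ q = step a (p ++ᵂ q)

  colours-++ : ∀ {u v w} (p : Walk E u v) (q : Walk E v w) →
               colours col (p ++ᵂ q) ≡ colours col p ++ colours col q
  colours-++ here       q = refl
  colours-++ (step a p) q = cong (_ ∷_) (colours-++ p q)

  adj-sym : ∀ {u w} → Adj E u w → Adj E w u
  adj-sym {inj₁ _} {inj₂ _} a = a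
  adj-sym {inj₂ _} {inj₁ _} a = a

  edgeCol-sym : ∀ {u w} (a : Adj E u w) → edgeCol col (adj-sym a) ≡ edgeCol col a
  edgeCol-sym {inj₁ _} {inj₂ _} a = refl
  edgeCol-sym {inj₂ _} {inj₁ _} a = refl

  reverseᵂ : ∀ {u v} → Walk E u v → Walk E v u
  reverseᵂ here       = here
  reverseᵂ (step a p) = reverseᵂ p ++ᵂ step (adj-sym a) here

  colours-reverse : ∀ {u v} (p : Walk E u v) → colours col (reverseᵂ p) ≡ reverse (colours col p)
  colours-reverse here = refl
  colours-reverse (step a p) = begin
    colours col (reverseᵂ p ++ᵂ step (adj-sym a) here)    ≡⟨ colours-++ (reverseᵂ p) _ ⟩
    colours col (reverseᵂ p) ++ [ edgeCol col (adj-sym a) ] ≡⟨ cong₂ _++_ (colours-reverse p) (cong [_] (edgeCol-sym a)) ⟩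
    reverse (colours col p) ++ [ edgeCol col a ]            ≡⟨ unfold-reverse (edgeCol col a) (colours col p) ⟨
    reverse (edgeCol col a ∷ colours col p)                 ∎
    where open ≡-Reasoning

  rainbow-reverse : ∀ {u v} → RainbowWalk u v → RainbowWalk v u
  rainbow-reverse (p , rainbow) =
    reverseᵂ p , subst Unique (sym (colours-reverse p)) (unique-reverse _ rainbow)

  suffix : ∀ {u w v} (q : Walk E w v) → u ∈ vertices q →
           Σ (Walk E u v) λ q′ → vertices q′ ⊆ vertices q × colours col q′ ⊆ colours col q
  suffix here       (here refl) = here , ⊆-refl , []
  suffix (step a q) (here refl) = step a q , ⊆-refl , ⊆-refl
  suffix (step a q) (there u∈q) with suffix q u∈q
  ... | q′ , vs , cs = q′ , (_ ∷ʳ vs) , (_ ∷ʳ cs)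

  -- Every walk contains a path with the same ends whose colours form a sublist:
  -- shorten the tail recursively; if the first vertex reappears on it, keep
  -- only the part of the tail from that vertex on, otherwise prepend the edge.
  shorten : ∀ {u v} (p : Walk E u v) → Σ (Walk E u v) λ q → IsPath q × colours col q ⊆ colours col p
  shorten here = here , [] ∷ [] , []
  shorten {u} (step a p) with shorten p
  ... | q , q-path , q⊆p with u ∈? vertices q
  ...   | yes u∈q with suffix q u∈q
  ...     | q′ , vs , cs = q′ , unique-sublist vs q-path , (_ ∷ʳ ⊆-trans cs q⊆p)
  shorten {u} (step a p) | q , q-path , q⊆p | no u∉q =
    step a q , ¬Any⇒All¬ _ u∉q ∷ q-path , (refl ∷ q⊆p)

  rainbow-connected : (∀ u v → RainbowWalk u v) → RainbowConnected {E = E} col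
  rainbow-connected walk u v _ with walk u v
  ... | p , rainbow with shorten p
  ...   | q , q-path , q⊆p = q , q-path , unique-sublist q⊆p rainbow

-- The class of a vertex relative to the fixed edge rs: the end r or s itself,
-- a vertex adjacent to the other end (C resp. A), or one that is not (D resp. B).
data Class : Set where
  centre near far : Class

classIndex : Class → Fin 3
classIndex centre = zero
classIndex near   = suc zero
classIndex far    = suc (suc zero)

pairColour : Class → Class → Fin 12
pairColour x y = inject≤ (combine (classIndex x) (classIndex y)) (m≤m+n 9 3)

module Construction {n k : ℕ} (E : BipGraph n n) (reg : Regular E k) (dense : n + 2 ≤ k + k)
                    (r s : Fin n) (rs : E r s ≡ true) where

  class₁ : Fin n → Class
  class₁ i = if does (i ≟ r) then centre else if E i s then near else far

  class₂ : Fin n → Class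
  class₂ j = if does (j ≟ s) then centre else if E r j then near else far

  class : Vertex n n → Class
  class (inj₁ i) = class₁ i
  class (inj₂ j) = class₂ j

  colouring : Colouring E 12
  colouring i j = pairColour (class₁ i) (class₂ j)

  open Walks E colouring

  class-r : class₁ r ≡ centre
  class-r rewrite dec-true (r ≟ r) refl = refl

  class-C : ∀ {c} → c ≢ r → E c s ≡ true → class₁ c ≡ near
  class-C {c} c≢r cs rewrite dec-false (c ≟ r) c≢r | cs = refl

  non-neighbour-of-s : ∀ {d} → E d s ≡ false → d ≢ r
  non-neighbour-of-s ds refl with () ← trans (sym rs) ds

  class-D : ∀ {d} → E d s ≡ false → class₁ d ≡ far
  class-D {d} ds rewrite dec-false (d ≟ r) (non-neighbour-of-s ds) | ds = refl

  class-s : class₂ s ≡ centre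
  class-s rewrite dec-true (s ≟ s) refl = refl

  class-A : ∀ {a} → a ≢ s → E r a ≡ true → class₂ a ≡ near
  class-A {a} a≢s ra rewrite dec-false (a ≟ s) a≢s | ra = refl

  non-neighbour-of-r : ∀ {b} → E r b ≡ false → b ≢ s
  non-neighbour-of-r rb refl with () ← trans (sym rs) rb

  class-B : ∀ {b} → E r b ≡ false → class₂ b ≡ far
  class-B {b} rb rewrite dec-false (b ≟ s) (non-neighbour-of-r rb) | rb = refl

  data View₁ : Fin n → Set where
    is-r : View₁ r
    in-C : ∀ {c} → c ≢ r → E c s ≡ true → View₁ c
    in-D : ∀ {d} → E d s ≡ false → View₁ d

  view₁ : ∀ i → View₁ i
  view₁ i with i ≟ r | E i s in i~s
  ... | yes refl | _     = is-r
  ... | no i≢r   | true  = in-C i≢r i~s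
  ... | no _     | false = in-D i~s

  data View₂ : Fin n → Set where
    is-s : View₂ s
    in-A : ∀ {a} → a ≢ s → E r a ≡ true → View₂ a
    in-B : ∀ {b} → E r b ≡ false → View₂ b

  view₂ : ∀ j → View₂ j
  view₂ j with j ≟ s | E r j in r~j
  ... | yes refl | _     = is-s
  ... | no j≢s   | true  = in-A j≢s r~j
  ... | no _     | false = in-B r~j

  degree₁ : ∀ i → count (E i) ≡ k
  degree₁ = proj₁ reg

  degree₂ : ∀ j → count (λ i → E i j) ≡ k
  degree₂ = proj₂ reg

  neighbour-in-A : ∀ i → ∃ λ a → E i a ≡ true × E r a ≡ true × a ≢ s
  neighbour-in-A i = common-element (E i) (E r) (degree₁ i) (degree₁ r) dense s

  neighbour-in-C : ∀ j → ∃ λ c → E c j ≡ true × E c s ≡ true × c ≢ r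
  neighbour-in-C j = common-element (λ i → E i j) (λ i → E i s) (degree₂ j) (degree₂ s) dense r

  neighbour-in-B : ∀ {d} → E d s ≡ false → ∃ λ b → E d b ≡ true × E r b ≡ false
  neighbour-in-B {d} ds =
    element-outside (E d) (E r) (≤-reflexive (trans (degree₁ r) (sym (degree₁ d)))) s rs ds

  neighbour-in-D : ∀ {b} → E r b ≡ false → ∃ λ d → E d b ≡ true × E d s ≡ false
  neighbour-in-D {b} rb =
    element-outside (λ i → E i b) (λ i → E i s) (≤-reflexive (trans (degree₂ s) (sym (degree₂ b)))) r rs rb

  -- A walk annotated with the class of each vertex; the index L is its colour
  -- list, which is therefore a closed term whose distinctness can be computed.
  data Route : Vertex n n → Class → Vertex n n → List (Fin 12) → Set where
    end    : ∀ {u x} → Route u x u []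
    step₁₂ : ∀ {i j x y v L} → E i j ≡ true → class₂ j ≡ y →
             Route (inj₂ j) y v L → Route (inj₁ i) x v (pairColour x y ∷ L)
    step₂₁ : ∀ {i j x y v L} → E i j ≡ true → class₁ i ≡ y →
             Route (inj₁ i) y v L → Route (inj₂ j) x v (pairColour y x ∷ L)

  realise : ∀ {u x v L} → class u ≡ x → Route u x v L →
            Σ (Walk E u v) λ p → colours colouring p ≡ L
  realise _ end = here , refl
  realise ci (step₁₂ a cj ρ) with realise cj ρ
  ... | p , cols = step a p , cong₂ _∷_ (cong₂ pairColour ci cj) cols
  realise cj (step₂₁ a ci ρ) with realise ci ρ
  ... | p , cols = step a p , cong₂ _∷_ (cong₂ pairColour ci cj) cols

  rainbow : ∀ {u x v L} → class u ≡ x → Route u x v L → {True (unique? L)} →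
            RainbowWalk u v
  rainbow cu ρ {distinct} with realise cu ρ
  ... | p , cols = p , subst Unique (sym cols) (toWitness distinct)

  walk-r-C : ∀ {c} → c ≢ r → E c s ≡ true → RainbowWalk (inj₁ r) (inj₁ c)
  walk-r-C c≢r cs = rainbow class-r (step₁₂ rs class-s (step₂₁ cs (class-C c≢r cs) end))

  walk-r-D : ∀ {d} → E d s ≡ false → RainbowWalk (inj₁ r) (inj₁ d)
  walk-r-D {d} ds with neighbour-in-A d
  ... | a , da , ra , a≢s =
    rainbow class-r (step₁₂ ra (class-A a≢s ra) (step₂₁ da (class-D ds) end))

  walk-C-C : ∀ {c c′} → c ≢ r → E c s ≡ true → c′ ≢ r → E c′ s ≡ true →
             RainbowWalk (inj₁ c) (inj₁ c′)
  walk-C-C {c′ = c′} c≢r cs c′≢r c′s with neighbour-in-A c′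
  ... | a , c′a , ra , a≢s =
    rainbow (class-C c≢r cs) (step₁₂ cs class-s (step₂₁ rs class-r
      (step₁₂ ra (class-A a≢s ra) (step₂₁ c′a (class-C c′≢r c′s) end))))

  walk-C-D : ∀ {c d} → c ≢ r → E c s ≡ true → E d s ≡ false →
             RainbowWalk (inj₁ c) (inj₁ d)
  walk-C-D {d = d} c≢r cs ds with neighbour-in-A d
  ... | a , da , ra , a≢s =
    rainbow (class-C c≢r cs) (step₁₂ cs class-s (step₂₁ rs class-r
      (step₁₂ ra (class-A a≢s ra) (step₂₁ da (class-D ds) end))))

  walk-D-D : ∀ {d d′} → E d s ≡ false → E d′ s ≡ false → RainbowWalk (inj₁ d) (inj₁ d′)
  walk-D-D {d} ds d′s with neighbour-in-A d | neighbour-in-B d′s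
  ... | a , da , ra , a≢s | b , d′b , rb with neighbour-in-C b
  ... | c , cb , cs , c≢r =
    rainbow (class-D ds) (step₁₂ da (class-A a≢s ra) (step₂₁ ra class-r (step₁₂ rs class-s
      (step₂₁ cs (class-C c≢r cs) (step₁₂ cb (class-B rb) (step₂₁ d′b (class-D d′s) end))))))

  walk₁₁ : ∀ i i′ → RainbowWalk (inj₁ i) (inj₁ i′)
  walk₁₁ i i′ with view₁ i | view₁ i′
  ... | is-r          | is-r            = here , []
  ... | is-r          | in-C c′≢r c′s   = walk-r-C c′≢r c′s
  ... | is-r          | in-D d′s        = walk-r-D d′s
  ... | in-C c≢r cs   | is-r            = rainbow-reverse (walk-r-C c≢r cs)
  ... | in-C c≢r cs   | in-C c′≢r c′s   = walk-C-C c≢r cs c′≢r c′s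
  ... | in-C c≢r cs   | in-D d′s        = walk-C-D c≢r cs d′s
  ... | in-D ds       | is-r            = rainbow-reverse (walk-r-D ds)
  ... | in-D ds       | in-C c′≢r c′s   = rainbow-reverse (walk-C-D c′≢r c′s ds)
  ... | in-D ds       | in-D d′s        = walk-D-D ds d′s

  walk₁₂ : ∀ i j → RainbowWalk (inj₁ i) (inj₂ j)
  walk₁₂ i j with view₁ i | view₂ j
  ... | is-r | is-s = rainbow class-r (step₁₂ rs class-s end)
  ... | is-r | in-A a≢s ra = rainbow class-r (step₁₂ ra (class-A a≢s ra) end)
  ... | is-r | in-B rb with neighbour-in-C j
  ...   | c , cb , cs , c≢r =
    rainbow class-r (step₁₂ rs class-s (step₂₁ cs (class-C c≢r cs) (step₁₂ cb (class-B rb) end)))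
  walk₁₂ i j | in-C c≢r cs | is-s = rainbow (class-C c≢r cs) (step₁₂ cs class-s end)
  walk₁₂ i j | in-C c≢r cs | in-A a≢s ra =
    rainbow (class-C c≢r cs) (step₁₂ cs class-s (step₂₁ rs class-r (step₁₂ ra (class-A a≢s ra) end)))
  walk₁₂ i j | in-C c≢r cs | in-B rb with neighbour-in-A i | neighbour-in-C j
  ...   | a , ca , ra , a≢s | c′ , c′b , c′s , c′≢r =
    rainbow (class-C c≢r cs) (step₁₂ ca (class-A a≢s ra) (step₂₁ ra class-r (step₁₂ rs class-s
      (step₂₁ c′s (class-C c′≢r c′s) (step₁₂ c′b (class-B rb) end)))))
  walk₁₂ i j | in-D ds | is-s with neighbour-in-A i
  ...   | a , da , ra , a≢s =
    rainbow (class-D ds) (step₁₂ da (class-A a≢s ra) (step₂₁ ra class-r (step₁₂ rs class-s end)))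
  walk₁₂ i j | in-D ds | in-A a≢s ra with neighbour-in-B ds
  ...   | b , db , rb with neighbour-in-C b
  ...     | c , cb , cs , c≢r =
    rainbow (class-D ds) (step₁₂ db (class-B rb) (step₂₁ cb (class-C c≢r cs) (step₁₂ cs class-s
      (step₂₁ rs class-r (step₁₂ ra (class-A a≢s ra) end)))))
  walk₁₂ i j | in-D ds | in-B rb with neighbour-in-A i | neighbour-in-C j
  ...   | a , da , ra , a≢s | c , cb , cs , c≢r =
    rainbow (class-D ds) (step₁₂ da (class-A a≢s ra) (step₂₁ ra class-r (step₁₂ rs class-s
      (step₂₁ cs (class-C c≢r cs) (step₁₂ cb (class-B rb) end)))))

  walk-s-A : ∀ {a} → a ≢ s → E r a ≡ true → RainbowWalk (inj₂ s) (inj₂ a)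
  walk-s-A a≢s ra = rainbow class-s (step₂₁ rs class-r (step₁₂ ra (class-A a≢s ra) end))

  walk-s-B : ∀ {b} → E r b ≡ false → RainbowWalk (inj₂ s) (inj₂ b)
  walk-s-B {b} rb with neighbour-in-C b
  ... | c , cb , cs , c≢r =
    rainbow class-s (step₂₁ cs (class-C c≢r cs) (step₁₂ cb (class-B rb) end))

  walk-A-A : ∀ {a a′} → a ≢ s → E r a ≡ true → a′ ≢ s → E r a′ ≡ true →
             RainbowWalk (inj₂ a) (inj₂ a′)
  walk-A-A {a′ = a′} a≢s ra a′≢s ra′ with neighbour-in-C a′
  ... | c , ca′ , cs , c≢r =
    rainbow (class-A a≢s ra) (step₂₁ ra class-r (step₁₂ rs class-s
      (step₂₁ cs (class-C c≢r cs) (step₁₂ ca′ (class-A a′≢s ra′) end))))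

  walk-A-B : ∀ {a b} → a ≢ s → E r a ≡ true → E r b ≡ false →
             RainbowWalk (inj₂ a) (inj₂ b)
  walk-A-B {b = b} a≢s ra rb with neighbour-in-C b
  ... | c , cb , cs , c≢r =
    rainbow (class-A a≢s ra) (step₂₁ ra class-r (step₁₂ rs class-s
      (step₂₁ cs (class-C c≢r cs) (step₁₂ cb (class-B rb) end))))

  walk-B-B : ∀ {b b′} → E r b ≡ false → E r b′ ≡ false → RainbowWalk (inj₂ b) (inj₂ b′)
  walk-B-B {b} rb rb′ with neighbour-in-C b | neighbour-in-D rb′
  ... | c , cb , cs , c≢r | d , db′ , ds with neighbour-in-A d
  ... | a , da , ra , a≢s =
    rainbow (class-B rb) (step₂₁ cb (class-C c≢r cs) (step₁₂ cs class-s (step₂₁ rs class-r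
      (step₁₂ ra (class-A a≢s ra) (step₂₁ da (class-D ds) (step₁₂ db′ (class-B rb′) end))))))

  walk₂₂ : ∀ j j′ → RainbowWalk (inj₂ j) (inj₂ j′)
  walk₂₂ j j′ with view₂ j | view₂ j′
  ... | is-s          | is-s            = here , []
  ... | is-s          | in-A a′≢s ra′   = walk-s-A a′≢s ra′
  ... | is-s          | in-B rb′        = walk-s-B rb′
  ... | in-A a≢s ra   | is-s            = rainbow-reverse (walk-s-A a≢s ra)
  ... | in-A a≢s ra   | in-A a′≢s ra′   = walk-A-A a≢s ra a′≢s ra′
  ... | in-A a≢s ra   | in-B rb′        = walk-A-B a≢s ra rb′
  ... | in-B rb       | is-s            = rainbow-reverse (walk-s-B rb)
  ... | in-B rb       | in-A a′≢s ra′   = rainbow-reverse (walk-A-B a′≢s ra′ rb)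
  ... | in-B rb       | in-B rb′        = walk-B-B rb rb′

  walk : ∀ u v → RainbowWalk u v
  walk (inj₁ i) (inj₁ i′) = walk₁₁ i i′
  walk (inj₁ i) (inj₂ j)  = walk₁₂ i j
  walk (inj₂ j) (inj₁ i)  = rainbow-reverse (walk₁₂ i j)
  walk (inj₂ j) (inj₂ j′) = walk₂₂ j j′

  rainbow-colouring : rc≤ E 12
  rainbow-colouring = colouring , rainbow-connected walk

corollary5 : (n k : ℕ) (E : BipGraph n n) → Regular E k → ⌈ n /2⌉ < k → rc≤ E 12
corollary5 zero    k E reg h<k = (λ ()) , λ { (inj₁ ()) ; (inj₂ ()) }
corollary5 (suc m) k E reg h<k with witness (E zero) zero-has-neighbour
  where
  zero-has-neighbour : 1 ≤ count (E zero)
  zero-has-neighbour = subst (1 ≤_) (sym (proj₁ reg zero)) (≤-trans (s≤s z≤n) h<k)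
... | s , rs = Construction.rainbow-colouring E reg (dense-bound (suc m) k h<k) zero s rs
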